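{- Let $\theta\ge\log_2 3$ be an irrational number and define $a_n=\lfloor n\theta\rfloor-\lfloor (n-1)\theta\rfloor$ for $n\ge1$. Then the E-sequence $(a_n)_{n\ge1}$ is $\Omega$-divergent.
   Context: An E-sequence is any infinite sequence $(a_n)_{n\ge1}$ of positive integers. For an odd positive integer $x$, its E-sequence is defined by $x_0=x$ and, for $n\ge1$, $x_n=\frac{3x_{n-1}+1}{2^{a_n}}$, where $a_n$ is the exponent of the largest power of $2$ dividing $3x_{n-1}+1$. An E-sequence is $\Omega$-divergent if it is not the E-sequence of any odd positive integer. -}

module Defs where

open import Data.Nat using (ℕ; zero; suc; _+_; _*_; _^_; _≤_; _<_)
open import Data.Nat.Divisibility using (_∣_)
open import Data.Integer using (+_)
open import Data.Rational.Unnormalised as Q using (ℚᵘ)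
open import Data.Product using (Σ; _×_; ∃)
open import Data.Sum using (_⊎_)
open import Relation.Nullary using (¬_)
open import Relation.Binary.PropositionalEquality using (_≡_)

-- A real number θ is represented by its (lower) Dedekind cut
-- L q  :⇔  q < θ, with the complement being the upper cut {q | q ≥ θ}.
record IrrationalReal : Set₁ where
  field
    L          : ℚᵘ → Set
    inhabited  : ∃ λ q → L q
    bounded    : ∃ λ q → ¬ L q
    downClosed : ∀ {p q} → p Q.≤ q → L q → L p
    rounded    : ∀ {q} → L q → ∃ λ r → q Q.< r × L r
    -- irrationality: θ is not rational, i.e. the upper cut {q | ¬ L q}
    -- has no least element
    irrational : ∀ {q} → ¬ L q → ∃ λ r → r Q.< q × ¬ L r
open IrrationalReal public

-- θ ≥ log₂ 3 : every positive rational p/d with 2^p < 3^d (i.e. p/d < log₂ 3)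
-- lies below θ.
AtLeastLog₂3 : IrrationalReal → Set
AtLeastLog₂3 θ = ∀ (p d : ℕ) → 2 ^ p < 3 ^ suc d → L θ ((+ p) Q./ suc d)

-- IsFloor θ n k  :⇔  k = ⌊ n θ ⌋  (for θ > 0 irrational; for n ≥ 1,
-- k ≤ nθ ⇔ k/n ≤ θ ⇔ k/n < θ since θ is irrational).
IsFloor : IrrationalReal → ℕ → ℕ → Set
IsFloor θ zero    k = k ≡ 0
IsFloor θ (suc m) k = L θ ((+ k) Q./ suc m) × ¬ L θ ((+ suc k) Q./ suc m)

Odd : ℕ → Set
Odd x = ¬ (2 ∣ x)

-- Sequences (a_n)_{n≥1} are functions ℕ → ℕ; the value at 0 is ignored.
-- (a_n) is the E-sequence of the odd x: with x_0 = x,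
-- 3 x_{n-1} + 1 = 2^{a_n} x_n and x_n odd (so a_n is the 2-adic valuation).
IsESequenceOf : (ℕ → ℕ) → ℕ → Set
IsESequenceOf a x =
  Σ (ℕ → ℕ) λ xs → xs 0 ≡ x ×
    (∀ n → (3 * xs n + 1 ≡ 2 ^ a (suc n) * xs (suc n)) × Odd (xs (suc n)))

IsESequence : (ℕ → ℕ) → Set
IsESequence a = ∀ n → 1 ≤ a (suc n)

ΩDivergent : (ℕ → ℕ) → Set
ΩDivergent a = IsESequence a × (∀ x → 1 ≤ x → Odd x → ¬ IsESequenceOf a x)

-- Write fl n = ⌊nθ⌋ and aₙ = fl n − fl (n−1).  Suppose some x had
-- (aₙ) as its E-sequence, with orbit x = x₀, x₁, x₂, …
--
-- Since θ ≥ log₂ 3, the mediant property of the cut of θ gives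
--    3ʲ · 2^(fl k) ≤ 2^(fl (k+j) + 1) for all k, j.  In particular fl is
--    strictly increasing (so every aₙ ≥ 1), and unrolling the orbit through
--    2^(fl n) xₙ = 3ⁿ x + Σₖ 3^(n−1−k) 2^(fl k) yields 3 xₙ ≤ 6x + 2n.
--  * Repetition.  Hence xₙ < N := 6x + 3 for n ≤ N, and by pigeonhole two
--    of x₀, …, x_N coincide, say xᵢ = x_{i+p} with p ≥ 1.
--  * Periodicity.  An orbit determines its next exponent and term, so from
--    index i on (aₙ) is p-periodic; hence fl (i + m p) = fl i + m c.
--  * Irrationality.  Along such a progression (fl i + m c)/(i + m p) tends
--    to c/p, so θ = c/p would follow; comparing c/p with θ on either side
--    of the cut contradicts the floor property for a suitable m.
module Submission where

open import Defs
open import Data.Nat using (ℕ; suc; _∸_)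
open import Data.Nat using (zero; _+_; _*_; _^_; _≤_; _<_; z≤n; s≤s; >-nonZero; _≤?_)
open import Data.Nat.Properties
open import Data.Nat.Tactic.RingSolver using (solve-∀)
open import Data.Nat.Divisibility using (_∣_; divides)
open import Data.Integer as Z using (+_; -[1+_]; +≤+; -≤+; +<+)
open import Data.Integer.Properties using (pos-*)
open import Data.Rational.Unnormalised as Q using (ℚᵘ; mkℚᵘ; *≤*; *<*)
open import Data.Product using (Σ; _×_; _,_; proj₁; proj₂)
open import Data.Sum using (inj₁; inj₂)
open import Data.Empty using (⊥; ⊥-elim)
open import Relation.Nullary using (¬_; yes; no)
open import Relation.Binary.PropositionalEquality
open import Data.Fin using (Fin; toℕ; fromℕ<)
open import Data.Fin.Properties using (toℕ<n; toℕ-fromℕ<; pigeonhole)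

-- The rational a/(1+d); this is the form in which `IsFloor` mentions rationals.
R : ℕ → ℕ → ℚᵘ
R a d = mkℚᵘ (+ a) d

R-≤ : ∀ {a b c d} → a * suc d ≤ c * suc b → R a b Q.≤ R c d
R-≤ {a} {b} {c} {d} h = *≤* (subst₂ Z._≤_ (pos-* a (suc d)) (pos-* c (suc b)) (+≤+ h))

pos-*-< : ∀ {a b c d} → + a Z.* + b Z.< + c Z.* + d → a * b < c * d
pos-*-< {a} {b} {c} {d} h with subst₂ Z._<_ (sym (pos-* a b)) (sym (pos-* c d)) h
... | +<+ k = k

R-≮-negative : ∀ {a b k d} → ¬ (+ a Z.* + b Z.< -[1+ k ] Z.* + suc d)
R-≮-negative {a} {b} {k} {d} h with subst (Z._< (-[1+ k ] Z.* + suc d)) (sym (pos-* a b)) h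
... | ()

even-pow2-multiple : ∀ b w → 2 ∣ 2 ^ suc b * w
even-pow2-multiple b w = divides (2 ^ b * w) (trans (*-assoc 2 (2 ^ b) w) (*-comm 2 (2 ^ b * w)))

two-adic-unique : ∀ a b z w → 2 ^ a * z ≡ 2 ^ b * w → Odd z → Odd w → a ≡ b
two-adic-unique zero    zero    z w e oz ow = refl
two-adic-unique zero    (suc b) z w e oz ow =
  ⊥-elim (oz (subst (2 ∣_) (trans (sym e) (*-identityˡ z)) (even-pow2-multiple b w)))
two-adic-unique (suc a) zero    z w e oz ow =
  ⊥-elim (ow (subst (2 ∣_) (trans e (*-identityˡ w)) (even-pow2-multiple a z)))
two-adic-unique (suc a) (suc b) z w e oz ow =
  cong suc (two-adic-unique a b z w (*-cancelˡ-≡ (2 ^ a * z) (2 ^ b * w) 2 halved) oz ow)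
  where
  halved : 2 * (2 ^ a * z) ≡ 2 * (2 ^ b * w)
  halved = trans (sym (*-assoc 2 (2 ^ a) z)) (trans e (*-assoc 2 (2 ^ b) w))

IsOrbit : (ℕ → ℕ) → (ℕ → ℕ) → Set
IsOrbit a xs = ∀ n → (3 * xs n + 1 ≡ 2 ^ a (suc n) * xs (suc n)) × Odd (xs (suc n))

orbit-step-determined : ∀ a xs → IsOrbit a xs → ∀ m m' → xs m ≡ xs m' →
  a (suc m) ≡ a (suc m') × xs (suc m) ≡ xs (suc m')
orbit-step-determined a xs orbit m m' e =
  exponents-equal ,
  *-cancelˡ-≡ (xs (suc m)) (xs (suc m')) (2 ^ a (suc m)) {{>-nonZero (m^n>0 2 (a (suc m)))}}
    (trans products-equal (cong (λ z → 2 ^ z * xs (suc m')) (sym exponents-equal)))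
  where
  products-equal : 2 ^ a (suc m) * xs (suc m) ≡ 2 ^ a (suc m') * xs (suc m')
  products-equal = trans (sym (proj₁ (orbit m))) (trans (cong (λ z → 3 * z + 1) e) (proj₁ (orbit m')))
  exponents-equal : a (suc m) ≡ a (suc m')
  exponents-equal = two-adic-unique _ _ _ _ products-equal (proj₂ (orbit m)) (proj₂ (orbit m'))

orbit-repeat-periodic : ∀ a xs → IsOrbit a xs → ∀ i j → xs i ≡ xs j →
  ∀ t → a (suc (i + t)) ≡ a (suc (j + t))
orbit-repeat-periodic a xs orbit i j e t = proj₁ (orbit-step-determined a xs orbit (i + t) (j + t) (terms t))
  where
  terms : ∀ t → xs (i + t) ≡ xs (j + t)
  terms zero    rewrite +-identityʳ i | +-identityʳ j = e
  terms (suc t) rewrite +-suc i t | +-suc j t = proj₂ (orbit-step-determined a xs orbit (i + t) (j + t) (terms t))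

module Increments (g d : ℕ → ℕ) (g-suc : ∀ n → g (suc n) ≡ g n + d n) where

  g-grows : ∀ m k → g m ≤ g (m + k)
  g-grows m zero    rewrite +-identityʳ m = ≤-refl
  g-grows m (suc k) rewrite +-suc m k =
    ≤-trans (g-grows m k) (≤-trans (m≤m+n (g (m + k)) (d (m + k))) (≤-reflexive (sym (g-suc (m + k)))))

  linear-along-period : ∀ i p → (∀ t → d (i + t) ≡ d (i + p + t)) →
    ∀ m → g (i + m * p) ≡ g i + m * (g (i + p) ∸ g i)
  linear-along-period i p periodic = along
    where
    j = i + p
    c = g j ∸ g i

    shifted : ∀ t → g (j + t) ≡ g (i + t) + c
    shifted zero    rewrite +-identityʳ i | +-identityʳ j = sym (m+[n∸m]≡n (g-grows i p))
    shifted (suc t) rewrite +-suc i t | +-suc j t = begin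
      g (suc (j + t))              ≡⟨ g-suc (j + t) ⟩
      g (j + t) + d (j + t)        ≡⟨ cong₂ _+_ (shifted t) (sym (periodic t)) ⟩
      g (i + t) + c + d (i + t)    ≡⟨ swap (g (i + t)) c (d (i + t)) ⟩
      g (i + t) + d (i + t) + c    ≡⟨ cong (_+ c) (sym (g-suc (i + t))) ⟩
      g (suc (i + t)) + c          ∎
      where
      open ≡-Reasoning
      swap : ∀ a b c → a + b + c ≡ a + c + b
      swap = solve-∀

    along : ∀ m → g (i + m * p) ≡ g i + m * c
    along zero    rewrite +-identityʳ i | +-identityʳ (g i) = refl
    along (suc m) = begin
      g (i + (p + m * p))  ≡⟨ cong g (sym (+-assoc i p (m * p))) ⟩
      g (j + m * p)        ≡⟨ shifted (m * p) ⟩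
      g (i + m * p) + c    ≡⟨ cong (_+ c) (along m) ⟩
      g i + m * c + c      ≡⟨ regroup (g i) m c ⟩
      g i + (c + m * c)    ∎
      where
      open ≡-Reasoning
      regroup : ∀ a m c → a + m * c + c ≡ a + (c + m * c)
      regroup = solve-∀

module Floor (θ : IrrationalReal) (fl : ℕ → ℕ) (isf : ∀ n → IsFloor θ n (fl n)) where

  floor-zero : fl 0 ≡ 0
  floor-zero = isf 0

  floor-below : ∀ n → L θ (R (fl (suc n)) n)
  floor-below n = proj₁ (isf (suc n))

  floor-succ-not-below : ∀ n → ¬ L θ (R (suc (fl (suc n))) n)
  floor-succ-not-below n = proj₂ (isf (suc n))

  -- The floor sequence is not linear along any arithmetic progression: such
  -- linearity would pin θ to the rational slope c/p.
  floor-not-linear : ∀ i q c → (∀ m → fl (i + m * suc q) ≡ fl i + m * c) → ⊥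
  floor-not-linear i q c linear = slope-not-above-θ slope-not-below-θ
    where
    p = suc q

    E : ℕ → ℕ
    E m = i + (q + m * p)

    E-suc : ∀ m → suc (E m) ≡ i + suc m * p
    E-suc m = sym (+-suc i (q + m * p))

    floor-E : ∀ m → fl (suc (E m)) ≡ fl i + suc m * c
    floor-E m = trans (cong fl (E-suc m)) (linear (suc m))

    below-E : ∀ m → L θ (R (fl i + suc m * c) (E m))
    below-E m = subst (λ z → L θ (R z (E m))) (floor-E m) (floor-below (E m))

    not-below-E : ∀ m → ¬ L θ (R (suc (fl i + suc m * c)) (E m))
    not-below-E m = subst (λ z → ¬ L θ (R (suc z) (E m))) (floor-E m) (floor-succ-not-below (E m))

    distribute : ∀ U i m p → U * i + m * (U * p) ≡ U * (i + m * p)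
    distribute = solve-∀

    -- c/p < θ: choose U/(1+v) strictly between; for m = v + fl i (1+v) the
    -- upper floor bound at E m lies below U/(1+v) < θ.
    slope-not-below-θ : L θ (R c q) → ⊥
    slope-not-below-θ below with rounded θ below
    ... | mkℚᵘ -[1+ k ] v , *<* lt , _ = R-≮-negative {c} {suc v} {k} {q} lt
    ... | mkℚᵘ (+ U) v , *<* lt , U-below = not-below-E m (downClosed θ (R-≤ bound) U-below)
      where
      m = v + fl i * suc v
      bound : suc (fl i + suc m * c) * suc v ≤ U * suc (E m)
      bound = begin
        suc (fl i + suc m * c) * suc v  ≡⟨ expand (fl i) c v ⟩
        suc m * suc (c * suc v)         ≤⟨ *-monoʳ-≤ (suc m) (pos-*-< {c} {suc v} {U} {p} lt) ⟩
        suc m * (U * p)                 ≤⟨ m≤n+m (suc m * (U * p)) (U * i) ⟩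
        U * i + suc m * (U * p)         ≡⟨ distribute U i (suc m) p ⟩
        U * (i + suc m * p)             ≡⟨ cong (U *_) (sym (E-suc m)) ⟩
        U * suc (E m)                   ∎
        where
        open ≤-Reasoning
        expand : ∀ A c v → suc (A + suc (v + A * suc v) * c) * suc v ≡ suc (v + A * suc v) * suc (c * suc v)
        expand = solve-∀

    -- θ < c/p: irrationality gives U/(1+v) with θ ≤ U/(1+v) < c/p; for
    -- m = U i the lower floor bound at E m lies above U/(1+v) ≥ θ.
    slope-not-above-θ : ¬ L θ (R c q) → ⊥
    slope-not-above-θ not-below with irrational θ not-below
    ... | mkℚᵘ -[1+ k ] v , _ , U-not-below =
      U-not-below (downClosed θ (*≤* (subst (_ Z.≤_) (pos-* (fl i + 1 * c) (suc v)) -≤+)) (below-E 0))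
    ... | mkℚᵘ (+ U) v , *<* lt , U-not-below = U-not-below (downClosed θ (R-≤ bound) (below-E m))
      where
      m = U * i
      bound : U * suc (E m) ≤ (fl i + suc m * c) * suc v
      bound = begin
        U * suc (E m)                       ≡⟨ cong (U *_) (E-suc m) ⟩
        U * (i + suc m * p)                 ≡⟨ sym (distribute U i (suc m) p) ⟩
        U * i + suc m * (U * p)             ≤⟨ +-monoˡ-≤ (suc m * (U * p)) (n≤1+n m) ⟩
        suc m + suc m * (U * p)             ≡⟨ *-suc (suc m) (U * p) ⟨
        suc m * suc (U * p)                 ≤⟨ *-monoʳ-≤ (suc m) (pos-*-< {U} {p} {c} {suc v} lt) ⟩
        suc m * (c * suc v)                 ≤⟨ m≤n+m (suc m * (c * suc v)) (fl i * suc v) ⟩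
        fl i * suc v + suc m * (c * suc v)  ≡⟨ collect (fl i) (suc m) c (suc v) ⟩
        (fl i + suc m * c) * suc v          ∎
        where
        open ≤-Reasoning
        collect : ∀ A m c s → A * s + m * (c * s) ≡ (A + m * c) * s
        collect = solve-∀

mediant-below : (θ : IrrationalReal) → ∀ a b c d →
  L θ (R a b) → L θ (R c d) → L θ (R (a + c) (suc (b + d)))
mediant-below θ a b c d a-below c-below with ≤-total (a * suc d) (c * suc b)
... | inj₁ a≤c = downClosed θ (R-≤ bound) c-below
  where
  bound : (a + c) * suc d ≤ c * suc (suc (b + d))
  bound = begin
    (a + c) * suc d          ≡⟨ *-distribʳ-+ (suc d) a c ⟩
    a * suc d + c * suc d    ≤⟨ +-monoˡ-≤ (c * suc d) a≤c ⟩
    c * suc b + c * suc d    ≡⟨ add-denominators c b d ⟩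
    c * suc (suc (b + d))    ∎
    where
    open ≤-Reasoning
    add-denominators : ∀ c b d → c * suc b + c * suc d ≡ c * suc (suc (b + d))
    add-denominators = solve-∀
... | inj₂ c≤a = downClosed θ (R-≤ bound) a-below
  where
  bound : (a + c) * suc b ≤ a * suc (suc (b + d))
  bound = begin
    (a + c) * suc b          ≡⟨ *-distribʳ-+ (suc b) a c ⟩
    a * suc b + c * suc b    ≤⟨ +-monoʳ-≤ (a * suc b) c≤a ⟩
    a * suc b + a * suc d    ≡⟨ add-denominators a b d ⟩
    a * suc (suc (b + d))    ∎
    where
    open ≤-Reasoning
    add-denominators : ∀ c b d → c * suc b + c * suc d ≡ c * suc (suc (b + d))
    add-denominators = solve-∀

module FloorAboveLog₂3 (θ : IrrationalReal) (ge : AtLeastLog₂3 θ)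
  (fl : ℕ → ℕ) (isf : ∀ n → IsFloor θ n (fl n)) where

  open Floor θ fl isf public

  -- If p/(1+j) < log₂ 3 ≤ θ then (fl k + p)/(1+k+j) < θ, by taking the
  -- mediant with fl k / k < θ (nothing to do when k = 0).
  gap-below : ∀ k j p → 2 ^ p < 3 ^ suc j → L θ (R (fl k + p) (k + j))
  gap-below zero    j p h rewrite floor-zero = ge p j h
  gap-below (suc k) j p h = mediant-below θ (fl (suc k)) k p j (floor-below k) (ge p j h)

  floor-gap : ∀ k j p → 2 ^ p < 3 ^ suc j → fl k + p ≤ fl (suc (k + j))
  floor-gap k j p h with fl k + p ≤? fl (suc (k + j))
  ... | yes le = le
  ... | no  gt = ⊥-elim (floor-succ-not-below (k + j)
                   (downClosed θ (R-≤ (*-monoˡ-≤ (suc (k + j)) (≰⇒> gt))) (gap-below k j p h)))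

  floor-increasing : ∀ n → fl n < fl (suc n)
  floor-increasing n = subst₂ _≤_ (+-comm (fl n) 1) (cong (λ m → fl (suc m)) (+-identityʳ n))
                         (floor-gap n 0 1 (s≤s (s≤s (s≤s z≤n))))

  -- The E-sequence aₙ = fl n − fl (n − 1) of the statement, and Δ n = a_{n+1}.
  increments : ℕ → ℕ
  increments n = fl n ∸ fl (n ∸ 1)

  Δ : ℕ → ℕ
  Δ n = fl (suc n) ∸ fl n

  floor-suc : ∀ n → fl (suc n) ≡ fl n + Δ n
  floor-suc n = sym (m+[n∸m]≡n (<⇒≤ (floor-increasing n)))

  open Increments fl Δ floor-suc public

  -- 3ʲ · 2^{fl k} ≤ 2^{fl (k+j) + 1}: a larger left side would give a p with
  -- 2ᵖ < 3ʲ and fl k + p = fl (k+j) + 1, contradicting `floor-gap`.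
  pow3-≤-pow2-floor : ∀ k j → 3 ^ j * 2 ^ fl k ≤ 2 ^ suc (fl (k + j))
  pow3-≤-pow2-floor k zero rewrite +-identityʳ k = +-monoʳ-≤ (2 ^ fl k) z≤n
  pow3-≤-pow2-floor k (suc j) with 3 ^ suc j * 2 ^ fl k ≤? 2 ^ suc (fl (k + suc j))
  ... | yes le = le
  ... | no  gt = ⊥-elim (<-irrefl refl (subst₂ _≤_ A+p (cong fl (sym (+-suc k j))) (floor-gap k j p p-small)))
    where
    A = fl k
    B = fl (k + suc j)
    p = suc B ∸ A
    A+p : A + p ≡ suc B
    A+p = m+[n∸m]≡n (≤-trans (g-grows k (suc j)) (n≤1+n B))
    p-small : 2 ^ p < 3 ^ suc j
    p-small = *-cancelˡ-< (2 ^ A) (2 ^ p) (3 ^ suc j) (begin-strict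
      2 ^ A * 2 ^ p    ≡⟨ ^-distribˡ-+-* 2 A p ⟨
      2 ^ (A + p)      ≡⟨ cong (2 ^_) A+p ⟩
      2 ^ suc B        <⟨ ≰⇒> gt ⟩
      3 ^ suc j * 2 ^ A ≡⟨ *-comm (3 ^ suc j) (2 ^ A) ⟩
      2 ^ A * 3 ^ suc j ∎)
      where open ≤-Reasoning

  module Orbit (x : ℕ) (xs : ℕ → ℕ) (xs0 : xs 0 ≡ x)
    (orbit : IsOrbit increments xs) where

    weighted : ℕ → ℕ
    weighted n = 2 ^ fl n * xs n

    weighted-suc : ∀ n → weighted (suc n) ≡ 3 * weighted n + 2 ^ fl n
    weighted-suc n = begin
      2 ^ fl (suc n) * xs (suc n)        ≡⟨ cong (λ e → 2 ^ e * xs (suc n)) (floor-suc n) ⟩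
      2 ^ (fl n + Δ n) * xs (suc n)      ≡⟨ cong (_* xs (suc n)) (^-distribˡ-+-* 2 (fl n) (Δ n)) ⟩
      2 ^ fl n * 2 ^ Δ n * xs (suc n)    ≡⟨ *-assoc (2 ^ fl n) (2 ^ Δ n) (xs (suc n)) ⟩
      2 ^ fl n * (2 ^ Δ n * xs (suc n))  ≡⟨ cong (2 ^ fl n *_) (sym (proj₁ (orbit n))) ⟩
      2 ^ fl n * (3 * xs n + 1)          ≡⟨ distribute (2 ^ fl n) (xs n) ⟩
      3 * weighted n + 2 ^ fl n          ∎
      where
      open ≡-Reasoning
      distribute : ∀ P x → P * (3 * x + 1) ≡ 3 * (P * x) + P
      distribute = solve-∀

    -- Unrolled, wₙ = 3ⁿ x + Σ_{k<n} 3^{n−1−k} 2^{fl k}; each of the n summands,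
    -- scaled by 3^{1+j}, is at most 2^{fl (n+j) + 1} by `pow3-≤-pow2-floor`.
    weighted-bound : ∀ n j → weighted n * 3 ^ suc j ≤ 3 ^ suc (n + j) * x + n * 2 ^ suc (fl (n + j))
    weighted-bound zero j rewrite floor-zero | xs0 =
      ≤-reflexive (trans (cong (_* 3 ^ suc j) (*-identityˡ x))
                  (trans (*-comm x (3 ^ suc j)) (sym (+-identityʳ _))))
    weighted-bound (suc n) j = begin
      weighted (suc n) * 3 ^ suc j
        ≡⟨ cong (_* 3 ^ suc j) (weighted-suc n) ⟩
      (3 * weighted n + 2 ^ fl n) * (3 * 3 ^ j)
        ≡⟨ expand (weighted n) (3 ^ j) (2 ^ fl n) ⟩
      weighted n * 3 ^ suc (suc j) + 3 ^ suc j * 2 ^ fl n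
        ≤⟨ +-mono-≤ (weighted-bound n (suc j)) (pow3-≤-pow2-floor n (suc j)) ⟩
      3 ^ suc (n + suc j) * x + n * 2 ^ suc (fl (n + suc j)) + 2 ^ suc (fl (n + suc j))
        ≡⟨ one-more-summand (3 ^ suc (n + suc j) * x) n (2 ^ suc (fl (n + suc j))) ⟩
      3 ^ suc (n + suc j) * x + suc n * 2 ^ suc (fl (n + suc j))
        ≡⟨ cong (λ m → 3 ^ suc m * x + suc n * 2 ^ suc (fl m)) (+-suc n j) ⟩
      3 ^ suc (suc n + j) * x + suc n * 2 ^ suc (fl (suc n + j))
        ∎
      where
      open ≤-Reasoning
      expand : ∀ y t P → (3 * y + P) * (3 * t) ≡ y * (3 * (3 * t)) + 3 * t * P
      expand = solve-∀
      one-more-summand : ∀ a n b → a + n * b + b ≡ a + suc n * b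
      one-more-summand = solve-∀

    -- Dividing by 2^{fl n} and using 3ⁿ ≤ 2^{fl n + 1}: 3 xₙ ≤ 6x + 2n.
    orbit-bound : ∀ n → xs n * 3 ≤ 6 * x + 2 * n
    orbit-bound n = *-cancelˡ-≤ P {{>-nonZero (m^n>0 2 (fl n))}} (begin
      P * (xs n * 3)                    ≡⟨ *-assoc P (xs n) 3 ⟨
      weighted n * 3 ^ 1                ≤⟨ weighted-bound n 0 ⟩
      3 ^ suc (n + 0) * x + n * 2 ^ suc (fl (n + 0))
                                        ≡⟨ cong (λ m → 3 ^ suc m * x + n * 2 ^ suc (fl m)) (+-identityʳ n) ⟩
      3 * 3 ^ n * x + n * (2 * P)       ≤⟨ +-monoˡ-≤ (n * (2 * P)) (*-monoˡ-≤ x (*-monoʳ-≤ 3 pow3-≤)) ⟩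
      3 * (2 * P) * x + n * (2 * P)     ≡⟨ factor P x n ⟩
      P * (6 * x + 2 * n)               ∎)
      where
      open ≤-Reasoning
      P = 2 ^ fl n
      pow3-≤ : 3 ^ n ≤ 2 * P
      pow3-≤ with pow3-≤-pow2-floor 0 n
      ... | le rewrite floor-zero = subst (_≤ 2 * P) (*-identityʳ (3 ^ n)) le
      factor : ∀ P x n → 3 * (2 * P) * x + n * (2 * P) ≡ P * (6 * x + 2 * n)
      factor = solve-∀

    N : ℕ
    N = suc (6 * x + 2)

    orbit-small : ∀ n → n ≤ N → xs n < N
    orbit-small n n≤N = s≤s (*-cancelʳ-≤ (xs n) (6 * x + 2) 3
      (≤-trans (orbit-bound n) (≤-trans (+-monoʳ-≤ (6 * x) (*-monoʳ-≤ 2 n≤N)) (≤-reflexive (bound x)))))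
      where
      bound : ∀ x → 6 * x + 2 * suc (6 * x + 2) ≡ (6 * x + 2) * 3
      bound = solve-∀

    term : Fin (suc N) → Fin N
    term k = fromℕ< (orbit-small (toℕ k) (≤-pred (toℕ<n k)))

    term-value : ∀ k → toℕ (term k) ≡ xs (toℕ k)
    term-value k = toℕ-fromℕ< (orbit-small (toℕ k) (≤-pred (toℕ<n k)))

    orbit-repeats : Σ ℕ λ i → Σ ℕ λ q → xs i ≡ xs (i + suc q)
    orbit-repeats =
      let i , j , i<j , same = pigeonhole (n<1+n N) term
          j-as-offset : toℕ i + suc (toℕ j ∸ suc (toℕ i)) ≡ toℕ j
          j-as-offset = trans (+-suc (toℕ i) _) (m+[n∸m]≡n i<j)
      in toℕ i , toℕ j ∸ suc (toℕ i) ,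
         trans (sym (term-value i)) (trans (cong toℕ same) (trans (term-value j) (cong xs (sym j-as-offset))))

corollary4p7 : (θ : IrrationalReal) → AtLeastLog₂3 θ →
    (fl : ℕ → ℕ) → (∀ n → IsFloor θ n (fl n)) →
    ΩDivergent (λ n → fl n ∸ fl (n ∸ 1))
corollary4p7 θ ge fl isf = increments-positive , no-orbit
  where
  open FloorAboveLog₂3 θ ge fl isf

  increments-positive : ∀ n → 1 ≤ Δ n
  increments-positive n = m<n⇒0<n∸m (floor-increasing n)

  -- A recurring orbit term makes the increments periodic, so fl would be
  -- linear along a progression, which `floor-not-linear` forbids.
  no-orbit : ∀ x → 1 ≤ x → Odd x → ¬ IsESequenceOf increments x
  no-orbit x _ _ (xs , xs0 , orbit) =
    let i , q , repeat = Orbit.orbit-repeats x xs xs0 orbit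
    in floor-not-linear i q (fl (i + suc q) ∸ fl i)
         (linear-along-period i (suc q) (orbit-repeat-periodic increments xs orbit i (i + suc q) repeat))
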